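{- Let $\mathbf{H}$ be an oligomorphic permutation group acting on a countable set $Y$, let $I$ be a countable index set, and for each $i\in I$ let $X_i$ be a countable set and let $f_i,g_i\colon X_i\to Y$ be functions such that $f_i=g_i$ holds locally modulo $\mathbf{H}$. Then there exist $e\in\overline{\mathbf{H}}$ and $e_i\in\overline{\mathbf{H}}$ for $i\in I$ such that $e f_i=e_i g_i$ for all $i\in I$; in particular, $f_i=g_i$ holds globally modulo $\overline{\mathbf{H}}$ for every $i\in I$.
   Context: A permutation group on a set is oligomorphic if for each $k\ge1$ its componentwise action on $k$-tuples has finitely many orbits. $\overline{\mathbf{H}}$ denotes the closure of $\mathbf{H}$ in $Y^Y$ with respect to the topology of pointwise convergence (product topology, $Y$ discrete); it is a monoid under composition. For functions $f,g\colon X\to Y$: $f=g$ holds locally modulo $\mathbf{H}$ if for every finite $F\subseteq X$ there exist $\beta_1,\beta_2\in\mathbf{H}$ with $\beta_1\circ f|_F=\beta_2\circ g|_F$; $f=g$ holds globally modulo $\overline{\mathbf{H}}$ if there exist $e_1,e_2\in\overline{\mathbf{H}}$ with $e_1\circ f=e_2\circ g$. -}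

module Defs where

open import Data.Nat using (ℕ)
open import Data.Fin using (Fin)
open import Data.List using (List)
open import Data.List.Membership.Propositional using (_∈_)
open import Data.List.Relation.Unary.Any using (Any)
open import Data.Product using (Σ; _×_; ∃-syntax)
open import Function using (_∘_; id)
open import Function.Definitions using (Injective)
open import Relation.Binary.PropositionalEquality using (_≡_)

Countable : Set → Set
Countable A = Σ (A → ℕ) λ c → Injective _≡_ _≡_ c

record PermGroup (Y : Set) : Set₁ where
  field
    _∈H    : (Y → Y) → Set
    resp   : ∀ {g h} → (∀ y → g y ≡ h y) → g ∈H → h ∈H
    id∈    : id ∈H
    ∘∈     : ∀ {g h} → g ∈H → h ∈H → (g ∘ h) ∈H
    inv∈   : ∀ {h} → h ∈H →
             Σ (Y → Y) λ h' → h' ∈H × (∀ y → h' (h y) ≡ y) × (∀ y → h (h' y) ≡ y)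
open PermGroup public

SameOrbit : {Y : Set} (H : PermGroup Y) {k : ℕ} → (Fin k → Y) → (Fin k → Y) → Set
SameOrbit H t t' = ∃[ h ] (_∈H H h × (∀ j → h (t j) ≡ t' j))

Oligomorphic : {Y : Set} → PermGroup Y → Set
Oligomorphic {Y} H = (k : ℕ) → Σ (List (Fin (Data.Nat.suc k) → Y)) λ reps →
  (t : Fin (Data.Nat.suc k) → Y) → Any (λ r → SameOrbit H r t) reps

-- e lies in the closure of H in Y^Y (pointwise convergence, Y discrete):
-- every basic neighbourhood {e' | e' agrees with e on finite F} meets H.
InClosure : {Y : Set} → PermGroup Y → (Y → Y) → Set
InClosure {Y} H e = (F : List Y) → ∃[ β ] (_∈H H β × (∀ {y} → y ∈ F → e y ≡ β y))

LocallyEq : {X Y : Set} → PermGroup Y → (X → Y) → (X → Y) → Set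
LocallyEq {X} H f g = (F : List X) → ∃[ β₁ ] ∃[ β₂ ]
  (_∈H H β₁ × _∈H H β₂ × (∀ {x} → x ∈ F → β₁ (f x) ≡ β₂ (g x)))

GloballyEq : {X Y : Set} → PermGroup Y → (X → Y) → (X → Y) → Set
GloballyEq H f g = ∃[ e₁ ] ∃[ e₂ ]
  (InClosure H e₁ × InClosure H e₂ × (∀ x → e₁ (f x) ≡ e₂ (g x)))

-- A compactness argument. Put Z = Y ⊎ (I × Y), pick γᵢₘ ∈ H with fᵢ = γᵢₘ gᵢ
-- on the first m points of Xᵢ, and let uₘ : Z → Y be the identity on Y and γᵢₘ
-- on the i-th copy of Y. Call s : Z → Y a cluster point on a finite L ⊆ Z if
-- s ∈ H uₘ on L for arbitrarily large m. Since H has finitely many orbits on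
-- tuples of each length, pigeonhole gives an index m₁ such that uₘ lies in the
-- H-orbit of uₘ₁ on L' for arbitrarily large m, so α₁ uₘ₁ (where s = α₁ uₘ₁ on
-- L) is a cluster point on L' agreeing with s on L. Iterating along an
-- exhaustion of the countable set Z gives a cluster point s on every finite
-- set; then e = s on Y and eᵢ = s on the i-th copy lie in the closure of H, and
-- e (fᵢ x) = eᵢ (gᵢ x) since both equal α (fᵢ x) = α (γᵢₘ (gᵢ x)) for some
-- α ∈ H and large m.
module Submission where

open import Defs
open import Axiom.ExcludedMiddle using (ExcludedMiddle)
open import Level using (0ℓ)
open import Data.Empty using (⊥-elim)
open import Data.Nat using (ℕ; zero; suc; _≤_; _<_; _≤′_; ≤′-refl; ≤′-step; _+_; _⊔_; s≤s)
open import Data.Nat.Properties using (≤-refl; ≤-trans; ≤-total; ≤⇒≤′; m≤n+m; m≤m+n; m≤m⊔n; m≤n⊔m)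
open import Data.List using (List; []; _∷_; _++_; map; length; lookup; cartesianProduct)
open import Data.List.Membership.Propositional using (_∈_)
open import Data.List.Membership.Propositional.Properties using (∈-map⁺; ∈-++⁺ˡ; ∈-++⁺ʳ; ∈-cartesianProduct⁺)
open import Data.List.Relation.Binary.Subset.Propositional using (_⊆_)
open import Data.List.Relation.Unary.Any using (Any; here; there; index; tail)
open import Data.List.Relation.Unary.Any.Properties using (lookup-index)
open import Data.Product using (Σ; _×_; ∃-syntax; _,_; proj₁; proj₂)
open import Data.Fin using (Fin)
open import Data.Sum using (_⊎_; inj₁; inj₂)
open import Function using (_∘_; id)
open import Relation.Nullary using (Dec; yes; no; ¬_)
open import Relation.Nullary.Decidable using (decidable-stable)
open import Relation.Binary.PropositionalEquality using (_≡_; refl; sym; trans; cong; subst; module ≡-Reasoning)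

AgreeOn : {X Y : Set} → List X → (X → Y) → (X → Y) → Set
AgreeOn K a b = ∀ {x} → x ∈ K → a x ≡ b x

Cofinal : (ℕ → Set) → Set
Cofinal P = ∀ M → ∃[ M' ] (M ≤ M' × P M')

cofinal-map : {P Q : ℕ → Set} → (∀ {M} → P M → Q M) → Cofinal P → Cofinal Q
cofinal-map P⇒Q cofinal M with cofinal M
... | M' , M≤M' , p = M' , M≤M' , P⇒Q p

cofinal-reindex : {P : ℕ → Set} (r : ℕ → ℕ) → (∀ M → M ≤ r M) → Cofinal (P ∘ r) → Cofinal P
cofinal-reindex r inflationary cofinal M with cofinal M
... | M' , M≤M' , p = r M' , ≤-trans M≤M' (inflationary M') , p

module Classical (em : ExcludedMiddle 0ℓ) where

  ¬cofinal⇒eventually¬ : {P : ℕ → Set} → ¬ Cofinal P → ∃[ M₀ ] (∀ {M} → M₀ ≤ M → ¬ P M)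
  ¬cofinal⇒eventually¬ {P} ¬cofinal with em {∃[ M₀ ] ¬ (∃[ M ] (M₀ ≤ M × P M))}
  ... | yes (M₀ , never) = M₀ , λ M₀≤M p → never (_ , M₀≤M , p)
  ... | no ¬eventually = ⊥-elim (¬cofinal λ M →
          decidable-stable em λ ¬later → ¬eventually (M , ¬later))

  cofinal-pigeonhole : {A : Set} (P : ℕ → A → Set) (xs : List A) →
    (∀ M → Any (P M) xs) → ∃[ x ] Cofinal (λ M → P M x)
  cofinal-pigeonhole P [] hit with hit 0
  ... | ()
  cofinal-pigeonhole P (x ∷ xs) hit with em {Cofinal (λ M → P M x)}
  ... | yes cofinal = x , cofinal
  ... | no ¬cofinal with ¬cofinal⇒eventually¬ ¬cofinal
  ...   | M₀ , never with cofinal-pigeonhole (λ M → P (M₀ + M)) xs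
                          (λ M → tail (never (m≤m+n M₀ M)) (hit (M₀ + M)))
  ...     | x' , cofinal' = x' , cofinal-reindex (M₀ +_) (λ M → m≤n+m M M₀) cofinal'

module Orbits {Y : Set} (H : PermGroup Y) where

  EquivOn : {X : Set} → List X → (X → Y) → (X → Y) → Set
  EquivOn K a b = ∃[ β ] (_∈H H β × AgreeOn K (β ∘ a) b)

  equivOn-[] : {X : Set} {a b : X → Y} → EquivOn [] a b
  equivOn-[] = id , id∈ H , λ ()

  equivOn-trans : {X : Set} {K : List X} {a b c : X → Y} →
    EquivOn K a b → EquivOn K b c → EquivOn K a c
  equivOn-trans (β , β∈H , βa≡b) (γ , γ∈H , γb≡c) =
    γ ∘ β , ∘∈ H γ∈H β∈H , λ x∈K → trans (cong γ (βa≡b x∈K)) (γb≡c x∈K)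

  inverse∈H : {h : Y → Y} → _∈H H h →
    ∃[ h' ] (_∈H H h' × (∀ {a b} → h a ≡ b → h' b ≡ a))
  inverse∈H h∈H with inv∈ H h∈H
  ... | h' , h'∈H , h'h≡id , _ = h' , h'∈H , λ ha≡b → trans (cong h' (sym ha≡b)) (h'h≡id _)

  locallyEq⇒equivOn : {X : Set} {f g : X → Y} → LocallyEq H f g → ∀ F → EquivOn F g f
  locallyEq⇒equivOn loc F with loc F
  ... | β₁ , β₂ , β₁∈H , β₂∈H , β₁f≡β₂g with inverse∈H β₁∈H
  ...   | β₁' , β₁'∈H , β₁'-inverts = β₁' ∘ β₂ , ∘∈ H β₁'∈H β₂∈H , β₁'-inverts ∘ β₁f≡β₂g

  sameOrbit⇒equivOn : {X : Set} (K : List X) {a b : X → Y} {r : Fin (length K) → Y} →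
    SameOrbit H r (a ∘ lookup K) → SameOrbit H r (b ∘ lookup K) → EquivOn K b a
  sameOrbit⇒equivOn K (h₁ , h₁∈H , h₁r≡a) (h₂ , h₂∈H , h₂r≡b) with inverse∈H h₂∈H
  ... | h₂' , h₂'∈H , h₂'-inverts =
    h₁ ∘ h₂' , ∘∈ H h₁∈H h₂'∈H ,
    agreeOn-lookup λ j → trans (cong h₁ (h₂'-inverts (h₂r≡b j))) (h₁r≡a j)
    where
      agreeOn-lookup : {a b : _ → Y} → (∀ j → a (lookup K j) ≡ b (lookup K j)) → AgreeOn K a b
      agreeOn-lookup {a} {b} pointwise x∈K =
        subst (λ x → a x ≡ b x) (sym (lookup-index x∈K)) (pointwise (index x∈K))

Exhaustion : Set → Set
Exhaustion A = Σ (ℕ → List A) λ layer → ∀ a → ∃[ n ] a ∈ layer n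

module Exhausted {A : Set} (exhaustion : Exhaustion A) where

  layer : ℕ → List A
  layer = proj₁ exhaustion

  depth : A → ℕ
  depth a = proj₁ (proj₂ exhaustion a)

  upTo : ℕ → List A
  upTo zero = []
  upTo (suc n) = layer n ++ upTo n

  upTo-mono′ : ∀ {n N} → n ≤′ N → upTo n ⊆ upTo N
  upTo-mono′ ≤′-refl = id
  upTo-mono′ (≤′-step n≤N) = ∈-++⁺ʳ (layer _) ∘ upTo-mono′ n≤N

  upTo-mono : ∀ {n N} → n ≤ N → upTo n ⊆ upTo N
  upTo-mono = upTo-mono′ ∘ ≤⇒≤′

  ∈-upTo : ∀ a {N} → depth a < N → a ∈ upTo N
  ∈-upTo a depth<N = upTo-mono depth<N (∈-++⁺ˡ (proj₂ (proj₂ exhaustion a)))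

  finite⊆upTo : (F : List A) → ∃[ N ] F ⊆ upTo N
  finite⊆upTo [] = 0 , λ ()
  finite⊆upTo (a ∷ F) with finite⊆upTo F
  ... | N , F⊆upTo = suc (depth a) ⊔ N , λ
    { (here refl) → ∈-upTo a (m≤m⊔n (suc (depth a)) N)
    ; (there a'∈F) → upTo-mono (m≤n⊔m (suc (depth a)) N) (F⊆upTo a'∈F)
    }

  module Stabilising {B : Set} (s : ℕ → A → B)
                     (stable : ∀ n → AgreeOn (upTo n) (s (suc n)) (s n)) where

    stable-≤′ : ∀ {n N} → n ≤′ N → AgreeOn (upTo n) (s N) (s n)
    stable-≤′ ≤′-refl a∈upTo = refl
    stable-≤′ (≤′-step n≤N) a∈upTo =
      trans (stable _ (upTo-mono′ n≤N a∈upTo)) (stable-≤′ n≤N a∈upTo)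

    limit : A → B
    limit a = s (suc (depth a)) a

    limit-agree : ∀ N → AgreeOn (upTo N) limit (s N)
    limit-agree N {a} a∈upTo with ≤-total (suc (depth a)) N
    ... | inj₁ depth<N = sym (stable-≤′ (≤⇒≤′ depth<N) (∈-upTo a ≤-refl))
    ... | inj₂ N≤depth = stable-≤′ (≤⇒≤′ N≤depth) a∈upTo

exhaustion-⊎ : {A B : Set} → Exhaustion A → Exhaustion B → Exhaustion (A ⊎ B)
exhaustion-⊎ {A} {B} (layerA , coverA) (layerB , coverB) = layer , cover
  where
    layer : ℕ → List (A ⊎ B)
    layer n = map inj₁ (layerA n) ++ map inj₂ (layerB n)
    cover : ∀ ab → ∃[ n ] ab ∈ layer n
    cover (inj₁ a) with coverA a
    ... | n , a∈ = n , ∈-++⁺ˡ (∈-map⁺ inj₁ a∈)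
    cover (inj₂ b) with coverB b
    ... | n , b∈ = n , ∈-++⁺ʳ (map inj₁ (layerA n)) (∈-map⁺ inj₂ b∈)

exhaustion-× : {A B : Set} → Exhaustion A → Exhaustion B → Exhaustion (A × B)
exhaustion-× {A} {B} exA exB = layer , λ (a , b) →
  A.depth a ⊔ B.depth b ,
  ∈-cartesianProduct⁺ (A.∈-upTo a (s≤s (m≤m⊔n (A.depth a) (B.depth b))))
                      (B.∈-upTo b (s≤s (m≤n⊔m (A.depth a) (B.depth b))))
  where
    module A = Exhausted exA
    module B = Exhausted exB
    layer : ℕ → List (A × B)
    layer n = cartesianProduct (A.upTo (suc n)) (B.upTo (suc n))

countable⇒exhaustion : ExcludedMiddle 0ℓ → {A : Set} → Countable A → Exhaustion A
countable⇒exhaustion em {A} (c , c-injective) = layer , λ a → c a , ∈-preimage a em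
  where
    preimage : ∀ {n} → Dec (∃[ a ] c a ≡ n) → List A
    preimage (yes (a , _)) = a ∷ []
    preimage (no _) = []
    layer : ℕ → List A
    layer n = preimage (em {∃[ a ] c a ≡ n})
    ∈-preimage : ∀ a (d : Dec (∃[ a' ] c a' ≡ c a)) → a ∈ preimage d
    ∈-preimage a (yes (a' , ca'≡ca)) = here (c-injective (sym ca'≡ca))
    ∈-preimage a (no nothing) = ⊥-elim (nothing (a , refl))

module Limits (em : ExcludedMiddle 0ℓ) {Y : Set} (H : PermGroup Y) (olig : Oligomorphic H) where
  open Classical em
  open Orbits H

  recurrent-equivOn : {X : Set} (K : List X) (v : ℕ → X → Y) →
    ∃[ M₁ ] Cofinal (λ M → EquivOn K (v M) (v M₁))
  recurrent-equivOn [] v = 0 , λ M → M , ≤-refl , equivOn-[]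
  recurrent-equivOn K@(_ ∷ K') v with olig (length K')
  ... | reps , covered
    with cofinal-pigeonhole (λ M r → SameOrbit H r (v M ∘ lookup K)) reps
                            (λ M → covered (v M ∘ lookup K))
  ...   | r , cofinal with cofinal 0
  ...     | M₁ , _ , orbit₁ =
    M₁ , cofinal-map (λ orbit → sameOrbit⇒equivOn K orbit₁ orbit) cofinal

  module _ {Z : Set} (u : ℕ → Z → Y) where

    ClusterOn : List Z → (Z → Y) → Set
    ClusterOn L s = Cofinal (λ m → EquivOn L (u m) s)

    clusterOn-restrict : ∀ {K L s s'} → K ⊆ L → AgreeOn K s s' → ClusterOn L s → ClusterOn K s'
    clusterOn-restrict K⊆L s≡s' = cofinal-map λ (β , β∈H , βu≡s) →
      β , β∈H , λ z∈K → trans (βu≡s (K⊆L z∈K)) (s≡s' z∈K)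

    clusterOn-extend : ∀ {L s} K → ClusterOn L s → ∃[ s' ] (ClusterOn K s' × AgreeOn L s' s)
    clusterOn-extend K cluster =
      let M₁ , recurrent = recurrent-equivOn K (u ∘ m)
          α₁ , α₁∈H , α₁u≡s = proj₂ (proj₂ (cluster M₁))
      in α₁ ∘ u (m M₁) ,
         cofinal-reindex m m-inflationary
           (cofinal-map (λ equiv → equivOn-trans equiv (α₁ , α₁∈H , λ _ → refl)) recurrent) ,
         α₁u≡s
      where
        m : ℕ → ℕ
        m M = proj₁ (cluster M)
        m-inflationary : ∀ M → M ≤ m M
        m-inflationary M = proj₁ (proj₂ (cluster M))

    clusterPoint : Exhaustion Z → ∃[ s ] (∀ F → ClusterOn F s)
    clusterPoint exhaustion = limit , λ F →
      let N , F⊆upTo = finite⊆upTo F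
      in clusterOn-restrict F⊆upTo (λ z∈F → sym (limit-agree N (F⊆upTo z∈F))) (proj₂ (approx N))
      where
        open Exhausted exhaustion
        approx : ∀ n → Σ (Z → Y) (ClusterOn (upTo n))
        extend : ∀ n → ∃[ s' ] (ClusterOn (upTo (suc n)) s' × AgreeOn (upTo n) s' (proj₁ (approx n)))
        approx zero = u 0 , λ M → M , ≤-refl , equivOn-[]
        approx (suc n) = proj₁ (extend n) , proj₁ (proj₂ (extend n))
        extend n = clusterOn-extend (upTo (suc n)) (proj₂ (approx n))
        open Stabilising (proj₁ ∘ approx) (proj₂ ∘ proj₂ ∘ extend)

    clusterPoint⇒closure : {s : Z → Y} (k : Y → Z) → (∀ m → _∈H H (u m ∘ k)) →
      (∀ F → ClusterOn F s) → InClosure H (s ∘ k)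
    clusterPoint⇒closure k uk∈H cluster F with cluster (map k F) 0
    ... | m , _ , α , α∈H , αu≡s = α ∘ u m ∘ k , ∘∈ H α∈H (uk∈H m) , λ y∈F → sym (αu≡s (∈-map⁺ k y∈F))

commonLeftFactor : ExcludedMiddle 0ℓ → {Y : Set} (H : PermGroup Y) → Oligomorphic H →
  {I : Set} {X : I → Set} → Exhaustion Y → Exhaustion I → ((i : I) → Exhaustion (X i)) →
  (f g : (i : I) → X i → Y) → ((i : I) → LocallyEq H (f i) (g i)) →
  Σ (Y → Y) λ e → InClosure H e ×
    Σ (I → Y → Y) λ es → (∀ i → InClosure H (es i)) × (∀ i x → e (f i x) ≡ es i (g i x))
commonLeftFactor em {Y} H olig {I} exY exI exX f g loc =
  s ∘ inj₁ , clusterPoint⇒closure u inj₁ (λ _ → id∈ H) cluster ,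
  (λ i → s ∘ inj₂ ∘ (i ,_)) ,
  (λ i → clusterPoint⇒closure u (inj₂ ∘ (i ,_)) (λ m → proj₁ (proj₂ (γ i m))) cluster) ,
  s-identifies
  where
    open Orbits H
    open Limits em H olig
    open module Domain (i : I) = Exhausted (exX i) using (upTo; depth; ∈-upTo)

    γ : ∀ i m → EquivOn (upTo i m) (g i) (f i)
    γ i m = locallyEq⇒equivOn (loc i) (upTo i m)

    u : ℕ → Y ⊎ (I × Y) → Y
    u m (inj₁ y) = y
    u m (inj₂ (i , y)) = proj₁ (γ i m) y

    point = clusterPoint u (exhaustion-⊎ exY (exhaustion-× exI exY))
    s = proj₁ point
    cluster = proj₂ point

    s-identifies : ∀ i x → s (inj₁ (f i x)) ≡ s (inj₂ (i , g i x))
    s-identifies i x with cluster (inj₁ (f i x) ∷ inj₂ (i , g i x) ∷ []) (suc (depth i x))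
    ... | m , depth<m , α , _ , αu≡s = begin
      s (inj₁ (f i x))           ≡⟨ sym (αu≡s (here refl)) ⟩
      α (f i x)                  ≡⟨ cong α (sym (proj₂ (proj₂ (γ i m)) (∈-upTo i x depth<m))) ⟩
      α (proj₁ (γ i m) (g i x))  ≡⟨ αu≡s (there (here refl)) ⟩
      s (inj₂ (i , g i x))       ∎
      where open ≡-Reasoning

lemma2p4 : ((P : Set) → Dec P) →
    (Y : Set) → Countable Y → (H : PermGroup Y) → Oligomorphic H →
    (I : Set) → Countable I → (X : I → Set) → ((i : I) → Countable (X i)) →
    (f g : (i : I) → X i → Y) → ((i : I) → LocallyEq H (f i) (g i)) →
    Σ (Y → Y) (λ e → InClosure H e ×
      Σ (I → Y → Y) (λ es → ((i : I) → InClosure H (es i)) ×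
        ((i : I) (x : X i) → e (f i x) ≡ es i (g i x))))
    × ((i : I) → GloballyEq H (f i) (g i))
lemma2p4 lem Y countableY H olig I countableI X countableX f g loc =
  let factorisation@(e , e∈H̄ , es , es∈H̄ , e≡es) =
        commonLeftFactor em H olig (exhaustion countableY) (exhaustion countableI)
                         (exhaustion ∘ countableX) f g loc
  in factorisation , λ i → e , es i , e∈H̄ , es∈H̄ i , e≡es i
  where
    em : ExcludedMiddle 0ℓ
    em {P} = lem P
    exhaustion : {A : Set} → Countable A → Exhaustion A
    exhaustion = countable⇒exhaustion em
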